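{- Let $\gamma,\alpha$ be umbrae and let $(\gamma,\alpha)$ be the exponential Riordan array they generate. Then for all $n\ge k\ge1$: \[ (\gamma,\alpha)_{n,k}\simeq\frac{n}{k}\sum_{i=0}^{n-k}\binom{n-1}{i}\alpha^i\,(\gamma,\alpha)_{n-1-i,k-1}, \] \[ (\gamma,\alpha)_{n,k}\simeq\frac{n}{k}\sum_{i=0}^{n-k}\binom{k-1+i}{i}\mathfrak K_\alpha^i\,(\gamma,\alpha)_{n-1,k-1+i}, \] \[ (\gamma,\alpha)_{n,k}\simeq\binom{n}{k}\sum_{i=0}^{n-k}(k.\mathfrak K_\alpha)^i\,(\gamma,\alpha)_{n-k,i}. \]
   Context: Classical umbral calculus: $R=\mathbb{C}[x]$, $A$ a saturated alphabet of umbrae, $E:R[A]\to R$ linear with $E[1]=1$ and $E[\alpha^i\beta^j\cdots]=E[\alpha^i]E[\beta^j]\cdots$ for distinct umbrae; $p\simeq q$ means $E[p]=E[q]$. $f_\alpha(t)=\sum_n E[\alpha^n]t^n/n!$. For an integer $x$ (possibly negative), $x.\alpha$ is an umbra with $(x.\alpha)^n\simeq n![t^n]f_\alpha(t)^x$. For umbrae $\sigma,\alpha$, $\mathfrak K_{\sigma,\alpha}$ is an umbra with $\mathfrak K_{\sigma,\alpha}^0=1$ and $\mathfrak K_{\sigma,\alpha}^n\simeq\sigma(\sigma+(-n).\alpha)^{n-1}$ for $n\ge1$ ($(-n).\alpha$ uncorrelated with $\sigma$); $\mathfrak K_\alpha:=\mathfrak K_{\alpha,\alpha}$. The exponential Riordan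 array $(\gamma,\alpha)$ is the lower triangular matrix with entries $(\gamma,\alpha)_{n,k}=E\big[\binom{n}{k}(\gamma+k.\alpha)^{n-k}\big]\in R$ for $n\ge k\ge0$, with $\gamma$ and $k.\alpha$ uncorrelated; in classical terms $(\gamma,\alpha)_{n,k}=n![t^n]f_\gamma(t)\frac{(tf_\alpha(t))^k}{k!}$. -}

module Defs where

open import Level using (Level)
open import Data.Nat using (ℕ; zero; suc; _∸_; _≡ᵇ_; _≤ᵇ_)
open import Data.Nat.Combinatorics using (_C_)
open import Data.Integer using (ℤ; +_; -[1+_])
open import Data.Bool using (if_then_else_)
open import Algebra.Bundles using (CommutativeRing)

-- Classical (moment-sequence) model of umbral calculus over a commutative
-- ring R (the paper uses R = ℂ[x]).  An umbra α is represented by its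
-- moment sequence  n ↦ E[α^n]  (with E[α^0] = 1 assumed where needed).
module Umbral {c ℓ : Level} (R : CommutativeRing c ℓ) where
  open CommutativeRing R

  fromℕ : ℕ → Carrier
  fromℕ zero = 0#
  fromℕ (suc n) = 1# + fromℕ n

  sumTo : ℕ → (ℕ → Carrier) → Carrier
  sumTo zero f = f 0
  sumTo (suc n) f = sumTo n f + f (suc n)

  bin : ℕ → ℕ → Carrier
  bin n k = fromℕ (n C k)

  -- moments of the unit umbra ε (f_ε = 1): E[ε^0]=1, E[ε^m]=0 for m>0
  δ : ℕ → Carrier
  δ zero = 1#
  δ (suc _) = 0#

  -- moments of the sum of two uncorrelated umbrae:
  -- E[(α+β)^m] = Σ_j C(m,j) E[α^j] E[β^(m-j)]
  conv : (ℕ → Carrier) → (ℕ → Carrier) → ℕ → Carrier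
  conv a b m = sumTo m (λ j → bin m j * (a j * b (m ∸ j)))

  -- moments of k.α  (k ≥ 0): n![t^n] f_α(t)^k
  natDot : (ℕ → Carrier) → ℕ → ℕ → Carrier
  natDot a zero = δ
  natDot a (suc k) = conv a (natDot a k)

  -- moments of (-1).α, i.e. n![t^n] f_α(t)^{-1}, computed by the
  -- recursion Σ_j C(m,j) a_j b_{m-j} = [m = 0] (valid when a 0 = 1).
  -- invTab N m equals b_m for all m ≤ N.
  invTab : (ℕ → Carrier) → ℕ → ℕ → Carrier
  invTab a zero m = δ m
  invTab a (suc N) m =
    if m ≡ᵇ suc N
    then - sumTo N (λ j → bin (suc N) (suc j) * (a (suc j) * invTab a N (N ∸ j)))
    else invTab a N m

  invMom : (ℕ → Carrier) → ℕ → Carrier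
  invMom a m = invTab a m m

  -- moments of x.α for an integer x: n![t^n] f_α(t)^x
  dot : (ℕ → Carrier) → ℤ → ℕ → Carrier
  dot a (+ k) = natDot a k
  dot a -[1+ k ] = natDot (invMom a) (suc k)

  -- moments of 𝔎_{σ,α}: 𝔎^0 = 1, 𝔎^n ≃ σ (σ + (-n).α)^{n-1}
  --   = Σ_j C(n-1,j) E[σ^{j+1}] E[((-n).α)^{n-1-j}]
  Kmom : (ℕ → Carrier) → (ℕ → Carrier) → ℕ → Carrier
  Kmom s a zero = 1#
  Kmom s a (suc n) =
    sumTo n (λ j → bin n j * (s (suc j) * dot a -[1+ n ] (n ∸ j)))

  K : (ℕ → Carrier) → ℕ → Carrier
  K a = Kmom a a

  -- exponential Riordan array entry (γ,α)_{n,k}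
  --   = E[C(n,k) (γ + k.α)^{n-k}] for n ≥ k, and 0 above the diagonal
  riordan : (ℕ → Carrier) → (ℕ → Carrier) → ℕ → ℕ → Carrier
  riordan g a n k =
    if k ≤ᵇ n then bin n k * conv g (natDot a k) (n ∸ k) else 0#

module Submission where

-- Passing from moments to generating functions, with
--   g = f_γ,  a = f_α,  b = f_{(-1).α} = 1/a,  κ = f_{𝔎_α},
-- one has  (γ,α)_{n,k} = n!/k! [t^{n-k}] g a^k,  and the three identities are
-- three ways of rewriting  g a^k :
--   (1)  g a^{k+1} = a · (g a^k);
--   (2)  g a^{k+1} = (g a^k) · a = (g a^k) · κ(t a) = Σ_i κ_i t^i g a^{k+i};
--   (3)  g a^k = g · κ(t a)^k = g · (κ^k)(t a) = Σ_i [t^i]κ^k · t^i g a^i,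
-- where  κ(t a(t)) = a(t)  is the defining property of 𝔎_α, obtained from its
-- explicit moments by Lagrange inversion.

open import Defs
open import Level using (Level)
open import Data.Nat using (ℕ; suc; _∸_; _+_; _≤_)
open import Data.Product using (_×_)
open import Algebra.Bundles using (CommutativeRing)

open import Data.Nat using (zero; _<_; z≤n; s≤s; _!; _≡ᵇ_)
import Data.Nat as ℕ
import Data.Nat.Properties as ℕP
open import Data.Nat.Combinatorics using (_C_; nCk≡n!/k![n-k]!; k![n∸k]!∣n!)
open import Data.Nat.DivMod using (m/n*n≡m)
open import Data.Nat.Induction using (<-rec)
open import Data.Bool using (true; false; T)
open import Data.Bool.Properties using (T-≡)
open import Data.Empty using (⊥-elim)
open import Data.Maybe using (nothing)
open import Data.Product using (_,_)
open import Function.Bundles using (Equivalence)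
open import Relation.Binary.PropositionalEquality as ≡ using (_≡_)

nCk*k!*[n∸k]!≡n! : ∀ {n k} → k ≤ n → (n C k) ℕ.* (k ! ℕ.* (n ∸ k) !) ≡ n !
nCk*k!*[n∸k]!≡n! {n} {k} k≤n =
  ≡.trans (≡.cong (ℕ._* (k ! ℕ.* (n ∸ k) !)) (nCk≡n!/k![n-k]! k≤n)) (m/n*n≡m (k![n∸k]!∣n! k≤n))
  where instance _ = k ℕP.!* (n ∸ k) !≢0

module _ {c ℓ : Level} (R : CommutativeRing c ℓ) where
  open CommutativeRing R renaming (_+_ to _+R_)
  open Umbral R
  open import Algebra.Properties.Ring ring using (-1*x≈-x; -‿distribʳ-*; +-cancelˡ; +-inverseʳ-unique)
  open import Algebra.Properties.Semiring.Mult semiring using (×-homo-+; ×1-homo-*) renaming (_×_ to _×ᴿ_)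
  open import Algebra.Solver.Ring.NaturalCoefficients commutativeSemiring (λ _ _ → nothing)
  open import Relation.Binary.Reasoning.Setoid setoid

  -- Finite sums  Σ_{i ≤ n} f i  (the operator sumTo of Defs).

  Σ-cong : ∀ n {f g : ℕ → Carrier} → (∀ i → i ≤ n → f i ≈ g i) → sumTo n f ≈ sumTo n g
  Σ-cong zero eq = eq 0 z≤n
  Σ-cong (suc n) eq = +-cong (Σ-cong n (λ i i≤n → eq i (ℕP.m≤n⇒m≤1+n i≤n))) (eq (suc n) ℕP.≤-refl)

  Σ-cong′ : ∀ n {f g : ℕ → Carrier} → (∀ i → f i ≈ g i) → sumTo n f ≈ sumTo n g
  Σ-cong′ n eq = Σ-cong n (λ i _ → eq i)

  Σ-+ : ∀ n (f g : ℕ → Carrier) → sumTo n (λ i → f i +R g i) ≈ sumTo n f +R sumTo n g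
  Σ-+ zero f g = refl
  Σ-+ (suc n) f g = trans (+-congʳ (Σ-+ n f g))
    (solve 4 (λ a b x y → (a :+ b) :+ (x :+ y) := (a :+ x) :+ (b :+ y)) refl _ _ _ _)

  *-distrib-Σ : ∀ n x (f : ℕ → Carrier) → x * sumTo n f ≈ sumTo n (λ i → x * f i)
  *-distrib-Σ zero x f = refl
  *-distrib-Σ (suc n) x f = trans (distribˡ x _ _) (+-congʳ (*-distrib-Σ n x f))

  -‿distrib-Σ : ∀ n (f : ℕ → Carrier) → - sumTo n f ≈ sumTo n (λ i → - f i)
  -‿distrib-Σ n f = trans (sym (-1*x≈-x _)) (trans (*-distrib-Σ n (- 1#) f) (Σ-cong′ n (λ i → -1*x≈-x (f i))))

  Σ-zero : ∀ n (f : ℕ → Carrier) → (∀ i → i ≤ n → f i ≈ 0#) → sumTo n f ≈ 0#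
  Σ-zero n f eq = trans (Σ-cong n eq) (vanish n)
    where
    vanish : ∀ n → sumTo n (λ _ → 0#) ≈ 0#
    vanish zero = refl
    vanish (suc n) = trans (+-identityʳ _) (vanish n)

  Σ-peel : ∀ n (f : ℕ → Carrier) → sumTo (suc n) f ≈ f 0 +R sumTo n (λ i → f (suc i))
  Σ-peel zero f = refl
  Σ-peel (suc n) f = trans (+-congʳ (Σ-peel n f)) (+-assoc _ _ _)

  Σ-swap : ∀ n m (f : ℕ → ℕ → Carrier) →
    sumTo n (λ i → sumTo m (f i)) ≈ sumTo m (λ j → sumTo n (λ i → f i j))
  Σ-swap zero m f = refl
  Σ-swap (suc n) m f = trans (+-congʳ (Σ-swap n m f)) (sym (Σ-+ m _ _))

  Σ-extend : ∀ {n m} (f : ℕ → Carrier) → n ≤ m → (∀ i → n < i → f i ≈ 0#) → sumTo n f ≈ sumTo m f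
  Σ-extend {n} f n≤m vanish = ≡.subst (λ m → sumTo n f ≈ sumTo m f) (ℕP.m∸n+n≡m n≤m) (sym (pad (_ ∸ n)))
    where
    pad : ∀ d → sumTo (d + n) f ≈ sumTo n f
    pad zero = refl
    pad (suc d) = trans (+-cong (pad d) (vanish (suc (d + n)) (s≤s (ℕP.m≤n+m n d)))) (+-identityʳ _)

  Σ-last : ∀ n (f : ℕ → Carrier) → (∀ i → i < n → f i ≈ 0#) → sumTo n f ≈ f n
  Σ-last zero f vanish = refl
  Σ-last (suc n) f vanish = trans (+-congʳ (Σ-zero n f (λ i i≤n → vanish i (s≤s i≤n)))) (+-identityˡ _)

  -- Formal power series over R, represented by their coefficient sequences.
  Series : Set c
  Series = ℕ → Carrier

  infix 4 _≋_
  _≋_ : Series → Series → Set ℓ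
  f ≋ g = ∀ m → f m ≈ g m

  infixl 7 _⊛_
  _⊛_ : Series → Series → Series
  (f ⊛ g) m = sumTo m (λ j → f j * g (m ∸ j))

  drop₁ : Series → Series
  drop₁ f j = f (suc j)

  ⊛-peel : ∀ f g m → (f ⊛ g) (suc m) ≈ f 0 * g (suc m) +R (drop₁ f ⊛ g) m
  ⊛-peel f g m = Σ-peel m _

  ⊛-cong-upTo : ∀ m {f f′ g g′} → (∀ i → i ≤ m → f i ≈ f′ i) → (∀ i → i ≤ m → g i ≈ g′ i) →
    (f ⊛ g) m ≈ (f′ ⊛ g′) m
  ⊛-cong-upTo m eqf eqg = Σ-cong m (λ i i≤m → *-cong (eqf i i≤m) (eqg (m ∸ i) (ℕP.m∸n≤m m i)))

  ⊛-cong : ∀ {f f′ g g′} → f ≋ f′ → g ≋ g′ → f ⊛ g ≋ f′ ⊛ g′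
  ⊛-cong eqf eqg m = ⊛-cong-upTo m (λ i _ → eqf i) (λ i _ → eqg i)

  ⊛-congˡ : ∀ f {g g′} → g ≋ g′ → f ⊛ g ≋ f ⊛ g′
  ⊛-congˡ f = ⊛-cong {f} {f} (λ _ → refl)

  ⊛-congʳ : ∀ {f f′} g → f ≋ f′ → f ⊛ g ≋ f′ ⊛ g
  ⊛-congʳ g eqf = ⊛-cong {g = g} {g′ = g} eqf (λ _ → refl)

  ⊛-comm : ∀ f g → f ⊛ g ≋ g ⊛ f
  ⊛-comm f g zero = *-comm _ _
  ⊛-comm f g (suc m) = begin
    (f ⊛ g) (suc m)                       ≈⟨ ⊛-peel f g m ⟩
    f 0 * g (suc m) +R (drop₁ f ⊛ g) m    ≈⟨ +-congˡ (⊛-comm (drop₁ f) g m) ⟩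
    f 0 * g (suc m) +R (g ⊛ drop₁ f) m    ≈⟨ exchange f g m ⟩
    g 0 * f (suc m) +R (f ⊛ drop₁ g) m    ≈⟨ +-congˡ (⊛-comm (drop₁ g) f m) ⟨
    g 0 * f (suc m) +R (drop₁ g ⊛ f) m    ≈⟨ ⊛-peel g f m ⟨
    (g ⊛ f) (suc m)                       ∎
    where
    -- both sides are  f 0 g (m+1) + g 0 f (m+1) + (drop₁ f ⊛ drop₁ g) (m-1)
    exchange : ∀ f g m → f 0 * g (suc m) +R (g ⊛ drop₁ f) m ≈ g 0 * f (suc m) +R (f ⊛ drop₁ g) m
    exchange f g zero = +-comm _ _
    exchange f g (suc m) = begin
      f 0 * g (suc (suc m)) +R (g ⊛ drop₁ f) (suc m)
        ≈⟨ +-congˡ (trans (⊛-peel g (drop₁ f) m) (+-congˡ (⊛-comm (drop₁ g) (drop₁ f) m))) ⟩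
      f 0 * g (suc (suc m)) +R (g 0 * f (suc (suc m)) +R (drop₁ f ⊛ drop₁ g) m)
        ≈⟨ solve 3 (λ a b c → a :+ (b :+ c) := b :+ (a :+ c)) refl _ _ _ ⟩
      g 0 * f (suc (suc m)) +R (f 0 * g (suc (suc m)) +R (drop₁ f ⊛ drop₁ g) m)
        ≈⟨ +-congˡ (⊛-peel f (drop₁ g) m) ⟨
      g 0 * f (suc (suc m)) +R (f ⊛ drop₁ g) (suc m) ∎

  ⊛-distribˡ : ∀ f g h → f ⊛ (λ i → g i +R h i) ≋ (λ m → (f ⊛ g) m +R (f ⊛ h) m)
  ⊛-distribˡ f g h m = trans (Σ-cong′ m (λ i → distribˡ _ _ _)) (Σ-+ m _ _)

  ⊛-distribʳ : ∀ f g h → (λ i → f i +R g i) ⊛ h ≋ (λ m → (f ⊛ h) m +R (g ⊛ h) m)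
  ⊛-distribʳ f g h m = trans (Σ-cong′ m (λ i → distribʳ _ _ _)) (Σ-+ m _ _)

  ⊛-scaleˡ : ∀ x f g → (λ i → x * f i) ⊛ g ≋ (λ m → x * (f ⊛ g) m)
  ⊛-scaleˡ x f g m = trans (Σ-cong′ m (λ i → *-assoc _ _ _)) (sym (*-distrib-Σ m x _))

  ⊛-scaleʳ : ∀ x f g → f ⊛ (λ i → x * g i) ≋ (λ m → x * (f ⊛ g) m)
  ⊛-scaleʳ x f g m = trans (Σ-cong′ m (λ i → solve 3 (λ a b c → a :* (b :* c) := b :* (a :* c)) refl _ _ _))
                          (sym (*-distrib-Σ m x _))

  ⊛-negʳ : ∀ f g → f ⊛ (λ i → - g i) ≋ (λ m → - (f ⊛ g) m)
  ⊛-negʳ f g m = trans (Σ-cong′ m (λ i → sym (-‿distribʳ-* _ _))) (sym (-‿distrib-Σ m _))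

  ⊛-assoc : ∀ f g h → (f ⊛ g) ⊛ h ≋ f ⊛ (g ⊛ h)
  ⊛-assoc f g h zero = *-assoc _ _ _
  ⊛-assoc f g h (suc m) = begin
    ((f ⊛ g) ⊛ h) (suc m)
      ≈⟨ ⊛-peel (f ⊛ g) h m ⟩
    (f 0 * g 0) * h (suc m) +R (drop₁ (f ⊛ g) ⊛ h) m
      ≈⟨ +-congˡ (trans (⊛-congʳ h (⊛-peel f g) m) (⊛-distribʳ _ _ h m)) ⟩
    (f 0 * g 0) * h (suc m) +R (((λ j → f 0 * drop₁ g j) ⊛ h) m +R ((drop₁ f ⊛ g) ⊛ h) m)
      ≈⟨ +-congˡ (+-cong (⊛-scaleˡ (f 0) (drop₁ g) h m) (⊛-assoc (drop₁ f) g h m)) ⟩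
    (f 0 * g 0) * h (suc m) +R (f 0 * (drop₁ g ⊛ h) m +R (drop₁ f ⊛ (g ⊛ h)) m)
      ≈⟨ solve 5 (λ a b c d e → (a :* b) :* c :+ (a :* d :+ e) := a :* (b :* c :+ d) :+ e) refl _ _ _ _ _ ⟩
    f 0 * (g 0 * h (suc m) +R (drop₁ g ⊛ h) m) +R (drop₁ f ⊛ (g ⊛ h)) m
      ≈⟨ +-congʳ (*-congˡ (⊛-peel g h m)) ⟨
    f 0 * (g ⊛ h) (suc m) +R (drop₁ f ⊛ (g ⊛ h)) m
      ≈⟨ ⊛-peel f (g ⊛ h) m ⟨
    (f ⊛ (g ⊛ h)) (suc m) ∎

  ⊛-interchange : ∀ f g h k → (f ⊛ g) ⊛ (h ⊛ k) ≋ (f ⊛ h) ⊛ (g ⊛ k)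
  ⊛-interchange f g h k m = begin
    ((f ⊛ g) ⊛ (h ⊛ k)) m  ≈⟨ ⊛-assoc f g (h ⊛ k) m ⟩
    (f ⊛ (g ⊛ (h ⊛ k))) m  ≈⟨ ⊛-congˡ f (λ r → sym (⊛-assoc g h k r)) m ⟩
    (f ⊛ ((g ⊛ h) ⊛ k)) m  ≈⟨ ⊛-congˡ f (⊛-congʳ k (⊛-comm g h)) m ⟩
    (f ⊛ ((h ⊛ g) ⊛ k)) m  ≈⟨ ⊛-congˡ f (⊛-assoc h g k) m ⟩
    (f ⊛ (h ⊛ (g ⊛ k))) m  ≈⟨ ⊛-assoc f h (g ⊛ k) m ⟨
    ((f ⊛ h) ⊛ (g ⊛ k)) m  ∎

  ⊛-zeroʳ : ∀ f → f ⊛ (λ _ → 0#) ≋ (λ _ → 0#)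
  ⊛-zeroʳ f m = Σ-zero m _ (λ i _ → zeroʳ _)

  ⊛-identityˡ : ∀ f → δ ⊛ f ≋ f
  ⊛-identityˡ f zero = *-identityˡ _
  ⊛-identityˡ f (suc m) = begin
    (δ ⊛ f) (suc m)                     ≈⟨ ⊛-peel δ f m ⟩
    1# * f (suc m) +R (drop₁ δ ⊛ f) m   ≈⟨ +-cong (*-identityˡ _) (Σ-zero m _ (λ i _ → zeroˡ _)) ⟩
    f (suc m) +R 0#                     ≈⟨ +-identityʳ _ ⟩
    f (suc m)                           ∎

  ⊛-identityʳ : ∀ f → f ⊛ δ ≋ f
  ⊛-identityʳ f m = trans (⊛-comm f δ m) (⊛-identityˡ f m)

  pow : Series → ℕ → Series
  pow f zero = δ
  pow f (suc k) = f ⊛ pow f k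

  pow-cong : ∀ {f g} → f ≋ g → ∀ k → pow f k ≋ pow g k
  pow-cong eq zero m = refl
  pow-cong eq (suc k) = ⊛-cong eq (pow-cong eq k)

  pow-+ : ∀ f i j → pow f (i + j) ≋ pow f i ⊛ pow f j
  pow-+ f zero j m = sym (⊛-identityˡ (pow f j) m)
  pow-+ f (suc i) j m = trans (⊛-congˡ f (pow-+ f i j) m) (sym (⊛-assoc f (pow f i) (pow f j) m))

  pow-⊛ : ∀ f g k → pow (f ⊛ g) k ≋ pow f k ⊛ pow g k
  pow-⊛ f g zero m = sym (⊛-identityˡ δ m)
  pow-⊛ f g (suc k) m = trans (⊛-congˡ (f ⊛ g) (pow-⊛ f g k) m) (⊛-interchange f g (pow f k) (pow g k) m)

  pow-δ : ∀ k → pow δ k ≋ δ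
  pow-δ zero m = refl
  pow-δ (suc k) m = trans (⊛-identityˡ (pow δ k) m) (pow-δ k m)

  pow-constant : ∀ f → f 0 ≈ 1# → ∀ k → pow f k 0 ≈ 1#
  pow-constant f f0 zero = refl
  pow-constant f f0 (suc k) = trans (*-cong f0 (pow-constant f f0 k)) (*-identityˡ 1#)

  t·_ : Series → Series
  (t· f) zero = 0#
  (t· f) (suc m) = f m

  t·-cong : ∀ {f g} → f ≋ g → t· f ≋ t· g
  t·-cong eq zero = refl
  t·-cong eq (suc m) = eq m

  ⊛-t·ˡ : ∀ f g → (t· f) ⊛ g ≋ t· (f ⊛ g)
  ⊛-t·ˡ f g zero = zeroˡ _
  ⊛-t·ˡ f g (suc m) = trans (⊛-peel (t· f) g m) (trans (+-congʳ (zeroˡ _)) (+-identityˡ _))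

  ⊛-t·ʳ : ∀ f g → f ⊛ (t· g) ≋ t· (f ⊛ g)
  ⊛-t·ʳ f g m = trans (⊛-comm f (t· g) m) (trans (⊛-t·ˡ g f m) (t·-cong (⊛-comm g f) m))

  t·-decompose : ∀ p → p ≋ (λ m → p 0 * δ m +R (t· drop₁ p) m)
  t·-decompose p zero = sym (trans (+-identityʳ _) (*-identityʳ _))
  t·-decompose p (suc m) = sym (trans (+-congʳ (zeroʳ _)) (+-identityˡ _))

  t^_·_ : ℕ → Series → Series
  t^ zero · h = h
  t^ suc i · h = t· (t^ i · h)

  t^·-cong : ∀ i {f g} → f ≋ g → t^ i · f ≋ t^ i · g
  t^·-cong zero eq = eq
  t^·-cong (suc i) eq = t·-cong (t^·-cong i eq)

  t^·-coeff : ∀ i h {m} → i ≤ m → (t^ i · h) m ≈ h (m ∸ i)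
  t^·-coeff i h {m} i≤m = reflexive (≡.trans (≡.cong (t^ i · h) (≡.sym (ℕP.m+[n∸m]≡n i≤m))) (shifted i (m ∸ i)))
    where
    shifted : ∀ i m → (t^ i · h) (i + m) ≡ h m
    shifted zero m = ≡.refl
    shifted (suc i) m = shifted i m

  t^·-low : ∀ i h {m} → m < i → (t^ i · h) m ≈ 0#
  t^·-low (suc i) h {zero} _ = refl
  t^·-low (suc i) h {suc m} (s≤s m<i) = t^·-low i h m<i

  ⊛-t^·ˡ : ∀ i f g → (t^ i · f) ⊛ g ≋ t^ i · (f ⊛ g)
  ⊛-t^·ˡ zero f g m = refl
  ⊛-t^·ˡ (suc i) f g m = trans (⊛-t·ˡ (t^ i · f) g m) (t·-cong (⊛-t^·ˡ i f g) m)

  ⊛-t^·ʳ : ∀ i f g → f ⊛ (t^ i · g) ≋ t^ i · (f ⊛ g)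
  ⊛-t^·ʳ i f g m = trans (⊛-comm f _ m) (trans (⊛-t^·ˡ i g f m) (t^·-cong i (⊛-comm g f) m))

  pow-t· : ∀ f i → pow (t· f) i ≋ t^ i · pow f i
  pow-t· f zero m = refl
  pow-t· f (suc i) m = begin
    (t· f ⊛ pow (t· f) i) m         ≈⟨ ⊛-congˡ (t· f) (pow-t· f i) m ⟩
    (t· f ⊛ (t^ i · pow f i)) m     ≈⟨ ⊛-t·ˡ f (t^ i · pow f i) m ⟩
    (t· (f ⊛ (t^ i · pow f i))) m   ≈⟨ t·-cong (⊛-t^·ʳ i f (pow f i)) m ⟩
    (t^ suc i · pow f (suc i)) m    ∎

  -- Composition.  A family X with  X i = O(t^i)  admits arbitrary linear
  -- combinations  Σ_i c_i X_i  (each coefficient is a finite sum); the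
  -- composite  c(t·a(t))  is the combination of the powers (t·a)^i.

  HasOrders : (ℕ → Series) → Set ℓ
  HasOrders X = ∀ i r → r < i → X i r ≈ 0#

  lincomb : (ℕ → Carrier) → (ℕ → Series) → Series
  lincomb c X m = sumTo m (λ i → c i * X i m)

  ⊛-lincomb : ∀ F c X → HasOrders X → F ⊛ lincomb c X ≋ lincomb c (λ i → F ⊛ X i)
  ⊛-lincomb F c X order m = begin
    sumTo m (λ j → F j * sumTo (m ∸ j) (λ i → c i * X i (m ∸ j)))
      ≈⟨ Σ-cong′ m (λ j → *-congˡ (Σ-extend _ (ℕP.m∸n≤m m j) (λ i lt → trans (*-congˡ (order i (m ∸ j) lt)) (zeroʳ _)))) ⟩
    sumTo m (λ j → F j * sumTo m (λ i → c i * X i (m ∸ j)))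
      ≈⟨ Σ-cong′ m (λ j → *-distrib-Σ m (F j) _) ⟩
    sumTo m (λ j → sumTo m (λ i → F j * (c i * X i (m ∸ j))))
      ≈⟨ Σ-swap m m _ ⟩
    sumTo m (λ i → sumTo m (λ j → F j * (c i * X i (m ∸ j))))
      ≈⟨ Σ-cong′ m (λ i → Σ-cong′ m (λ j → solve 3 (λ a b x → a :* (b :* x) := b :* (a :* x)) refl (F j) (c i) _)) ⟩
    sumTo m (λ i → sumTo m (λ j → c i * (F j * X i (m ∸ j))))
      ≈⟨ Σ-cong′ m (λ i → *-distrib-Σ m (c i) _) ⟨
    sumTo m (λ i → c i * (F ⊛ X i) m) ∎

  pow-t·-orders : ∀ a → HasOrders (pow (t· a))
  pow-t·-orders a i r r<i = trans (pow-t· a i r) (t^·-low i (pow a i) r<i)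

  comp : (ℕ → Carrier) → Series → Series
  comp c a = lincomb c (pow (t· a))

  comp-coeff : ∀ F c a m → (F ⊛ comp c a) m ≈ sumTo m (λ i → c i * (F ⊛ pow a i) (m ∸ i))
  comp-coeff F c a m = trans (⊛-lincomb F c (pow (t· a)) (pow-t·-orders a) m) (Σ-cong m (λ i i≤m → *-congˡ (begin
    (F ⊛ pow (t· a) i) m       ≈⟨ ⊛-congˡ F (pow-t· a i) m ⟩
    (F ⊛ (t^ i · pow a i)) m   ≈⟨ ⊛-t^·ʳ i F (pow a i) m ⟩
    (t^ i · (F ⊛ pow a i)) m   ≈⟨ t^·-coeff i _ i≤m ⟩
    (F ⊛ pow a i) (m ∸ i)      ∎)))

  comp-cong : ∀ {c d} a → (∀ i → c i ≈ d i) → comp c a ≋ comp d a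
  comp-cong a eq m = Σ-cong′ m (λ i → *-congʳ (eq i))

  comp-δ : ∀ a → comp δ a ≋ δ
  comp-δ a zero = *-identityˡ _
  comp-δ a (suc m) = trans (Σ-peel m _) (trans (+-cong (*-identityˡ _) (Σ-zero m _ (λ i _ → zeroˡ _))) (+-identityʳ _))

  comp-t· : ∀ p a → comp (t· p) a ≋ t· a ⊛ comp p a
  comp-t· p a m = trans (shifted m) (sym (⊛-lincomb (t· a) p (pow (t· a)) (pow-t·-orders a) m))
    where
    highest-vanishes : ∀ m → p m * pow (t· a) (suc m) m ≈ 0#
    highest-vanishes m = trans (*-congˡ (pow-t·-orders a (suc m) m ℕP.≤-refl)) (zeroʳ _)
    shifted : ∀ m → comp (t· p) a m ≈ sumTo m (λ i → p i * pow (t· a) (suc i) m)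
    shifted zero = trans (zeroˡ _) (sym (highest-vanishes 0))
    shifted (suc m) = begin
      comp (t· p) a (suc m)                                               ≈⟨ Σ-peel m _ ⟩
      0# * pow (t· a) 0 (suc m) +R sumTo m (λ i → p i * pow (t· a) (suc i) (suc m)) ≈⟨ trans (+-congʳ (zeroˡ _)) (+-identityˡ _) ⟩
      sumTo m (λ i → p i * pow (t· a) (suc i) (suc m))                    ≈⟨ +-identityʳ _ ⟨
      sumTo m (λ i → p i * pow (t· a) (suc i) (suc m)) +R 0#              ≈⟨ +-congˡ (highest-vanishes (suc m)) ⟨
      sumTo (suc m) (λ i → p i * pow (t· a) (suc i) (suc m))              ∎

  comp-affine : ∀ x f g a → comp (λ m → x * f m +R (t· g) m) a ≋ (λ m → x * comp f a m +R (t· a ⊛ comp g a) m)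
  comp-affine x f g a m = begin
    comp (λ m → x * f m +R (t· g) m) a m
      ≈⟨ trans (Σ-cong′ m (λ i → distribʳ _ _ _)) (Σ-+ m _ _) ⟩
    comp (λ m → x * f m) a m +R comp (t· g) a m
      ≈⟨ +-cong (trans (Σ-cong′ m (λ i → *-assoc _ _ _)) (sym (*-distrib-Σ m x _))) (comp-t· g a m) ⟩
    x * comp f a m +R (t· a ⊛ comp g a) m ∎

  comp-decompose : ∀ p a → comp p a ≋ (λ m → p 0 * δ m +R (t· a ⊛ comp (drop₁ p) a) m)
  comp-decompose p a m = trans (comp-cong a (t·-decompose p) m)
    (trans (comp-affine (p 0) δ (drop₁ p) a m) (+-congʳ (*-congˡ (comp-δ a m))))

  ⊛-decompose : ∀ p q → p ⊛ q ≋ (λ m → p 0 * q m +R (t· (drop₁ p ⊛ q)) m)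
  ⊛-decompose p q m = begin
    (p ⊛ q) m                                                ≈⟨ ⊛-congʳ q (t·-decompose p) m ⟩
    ((λ i → p 0 * δ i +R (t· drop₁ p) i) ⊛ q) m              ≈⟨ ⊛-distribʳ _ _ q m ⟩
    ((λ i → p 0 * δ i) ⊛ q) m +R ((t· drop₁ p) ⊛ q) m         ≈⟨ +-cong (trans (⊛-scaleˡ (p 0) δ q m) (*-congˡ (⊛-identityˡ q m))) (⊛-t·ˡ (drop₁ p) q m) ⟩
    p 0 * q m +R (t· (drop₁ p ⊛ q)) m                        ∎

  ⊛-t·-upTo : ∀ a X Y n → (∀ r → r < n → X r ≈ Y r) → (t· a ⊛ X) n ≈ (t· a ⊛ Y) n
  ⊛-t·-upTo a X Y zero _ = trans (zeroˡ _) (sym (zeroˡ _))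
  ⊛-t·-upTo a X Y (suc n) eq = trans (⊛-t·ˡ a X (suc n))
    (trans (⊛-cong-upTo n (λ _ _ → refl) (λ r r≤n → eq r (s≤s r≤n))) (sym (⊛-t·ˡ a Y (suc n))))

  comp-⊛ : ∀ a q p → comp (p ⊛ q) a ≋ comp p a ⊛ comp q a
  comp-⊛ a q p n = <-rec (λ n → ∀ p → comp (p ⊛ q) a n ≈ (comp p a ⊛ comp q a) n) step n p
    where
    step : ∀ n → (∀ {m} → m < n → ∀ p → comp (p ⊛ q) a m ≈ (comp p a ⊛ comp q a) m) →
           ∀ p → comp (p ⊛ q) a n ≈ (comp p a ⊛ comp q a) n
    step n ih p = begin
      comp (p ⊛ q) a n
        ≈⟨ comp-cong a (⊛-decompose p q) n ⟩
      comp (λ m → p 0 * q m +R (t· (drop₁ p ⊛ q)) m) a n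
        ≈⟨ comp-affine (p 0) q (drop₁ p ⊛ q) a n ⟩
      p 0 * comp q a n +R (t· a ⊛ comp (drop₁ p ⊛ q) a) n
        ≈⟨ +-congˡ (⊛-t·-upTo a _ _ n (λ r r<n → ih r<n (drop₁ p))) ⟩
      p 0 * comp q a n +R (t· a ⊛ (comp (drop₁ p) a ⊛ comp q a)) n
        ≈⟨ +-cong (*-congˡ (sym (⊛-identityˡ (comp q a) n))) (sym (⊛-assoc (t· a) (comp (drop₁ p) a) (comp q a) n)) ⟩
      p 0 * (δ ⊛ comp q a) n +R ((t· a ⊛ comp (drop₁ p) a) ⊛ comp q a) n
        ≈⟨ +-congʳ (sym (⊛-scaleˡ (p 0) δ (comp q a) n)) ⟩
      ((λ i → p 0 * δ i) ⊛ comp q a) n +R ((t· a ⊛ comp (drop₁ p) a) ⊛ comp q a) n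
        ≈⟨ ⊛-distribʳ _ _ (comp q a) n ⟨
      ((λ m → p 0 * δ m +R (t· a ⊛ comp (drop₁ p) a) m) ⊛ comp q a) n
        ≈⟨ ⊛-congʳ (comp q a) (comp-decompose p a) n ⟨
      (comp p a ⊛ comp q a) n ∎

  comp-pow : ∀ p a k → comp (pow p k) a ≋ pow (comp p a) k
  comp-pow p a zero = comp-δ a
  comp-pow p a (suc k) m = trans (comp-⊛ a (pow p k) p m) (⊛-congˡ (comp p a) (comp-pow p a k) m)

  -- fromℕ n is the n-fold sum of 1#, hence the library homomorphism lemmas apply.
  fromℕ≡× : ∀ n → fromℕ n ≡ n ×ᴿ 1#
  fromℕ≡× zero = ≡.refl
  fromℕ≡× (suc n) = ≡.cong (1# +R_) (fromℕ≡× n)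

  fromℕ-+ : ∀ i j → fromℕ (i + j) ≈ fromℕ i +R fromℕ j
  fromℕ-+ i j = begin
    fromℕ (i + j)            ≡⟨ fromℕ≡× (i + j) ⟩
    (i + j) ×ᴿ 1#             ≈⟨ ×-homo-+ 1# i j ⟩
    i ×ᴿ 1# +R j ×ᴿ 1#         ≡⟨ ≡.cong₂ _+R_ (fromℕ≡× i) (fromℕ≡× j) ⟨
    fromℕ i +R fromℕ j       ∎

  fromℕ-* : ∀ i j → fromℕ (i ℕ.* j) ≈ fromℕ i * fromℕ j
  fromℕ-* i j = begin
    fromℕ (i ℕ.* j)          ≡⟨ fromℕ≡× (i ℕ.* j) ⟩
    (i ℕ.* j) ×ᴿ 1#           ≈⟨ ×1-homo-* i j ⟩
    (i ×ᴿ 1#) * (j ×ᴿ 1#)      ≡⟨ ≡.cong₂ _*_ (fromℕ≡× i) (fromℕ≡× j) ⟨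
    fromℕ i * fromℕ j        ∎

  -- The Euler operator  θ = t d/dt :  (θ f) m = m f m.

  θ : Series → Series
  θ f m = fromℕ m * f m

  θ-cong : ∀ {f g} → f ≋ g → θ f ≋ θ g
  θ-cong eq m = *-congˡ (eq m)

  θ-lincomb : ∀ c X → θ (lincomb c X) ≋ lincomb c (λ i → θ (X i))
  θ-lincomb c X m = trans (*-distrib-Σ m _ _) (Σ-cong′ m (λ i → solve 3 (λ x y z → x :* (y :* z) := y :* (x :* z)) refl _ _ _))

  θ-orders : ∀ {X} → HasOrders X → HasOrders (λ i → θ (X i))
  θ-orders order i r r<i = trans (*-congˡ (order i r r<i)) (zeroʳ _)

  θ-⊛ : ∀ f g → θ (f ⊛ g) ≋ (λ m → (θ f ⊛ g) m +R (f ⊛ θ g) m)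
  θ-⊛ f g m = trans (*-distrib-Σ m _ _) (trans (Σ-cong m split) (Σ-+ m _ _))
    where
    split : ∀ j → j ≤ m → fromℕ m * (f j * g (m ∸ j)) ≈ (fromℕ j * f j) * g (m ∸ j) +R f j * (fromℕ (m ∸ j) * g (m ∸ j))
    split j j≤m = begin
      fromℕ m * (f j * g (m ∸ j))
        ≡⟨ ≡.cong (λ n → fromℕ n * (f j * g (m ∸ j))) (ℕP.m+[n∸m]≡n j≤m) ⟨
      fromℕ (j + (m ∸ j)) * (f j * g (m ∸ j))
        ≈⟨ *-congʳ (fromℕ-+ j (m ∸ j)) ⟩
      (fromℕ j +R fromℕ (m ∸ j)) * (f j * g (m ∸ j))
        ≈⟨ solve 4 (λ a b x y → (a :+ b) :* (x :* y) := (a :* x) :* y :+ x :* (b :* y)) refl _ _ _ _ ⟩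
      (fromℕ j * f j) * g (m ∸ j) +R f j * (fromℕ (m ∸ j) * g (m ∸ j)) ∎

  θ-δ : θ δ ≋ (λ _ → 0#)
  θ-δ zero = zeroˡ _
  θ-δ (suc m) = zeroʳ _

  θ-pow : ∀ f k → θ (pow f (suc k)) ≋ (λ m → fromℕ (suc k) * (pow f k ⊛ θ f) m)
  θ-pow f zero m = begin
    θ (f ⊛ δ) m                 ≈⟨ θ-cong (⊛-identityʳ f) m ⟩
    θ f m                       ≈⟨ ⊛-identityˡ (θ f) m ⟨
    (δ ⊛ θ f) m                 ≈⟨ *-identityˡ _ ⟨
    1# * (δ ⊛ θ f) m            ≈⟨ *-congʳ (+-identityʳ 1#) ⟨
    (1# +R 0#) * (δ ⊛ θ f) m    ∎
  θ-pow f (suc k) m = begin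
    θ (f ⊛ pow f (suc k)) m
      ≈⟨ θ-⊛ f (pow f (suc k)) m ⟩
    (θ f ⊛ pow f (suc k)) m +R (f ⊛ θ (pow f (suc k))) m
      ≈⟨ +-cong (⊛-comm (θ f) (pow f (suc k)) m) (trans (⊛-congˡ f (θ-pow f k) m) (⊛-scaleʳ (fromℕ (suc k)) f (pow f k ⊛ θ f) m)) ⟩
    (pow f (suc k) ⊛ θ f) m +R fromℕ (suc k) * (f ⊛ (pow f k ⊛ θ f)) m
      ≈⟨ +-congˡ (*-congˡ (sym (⊛-assoc f (pow f k) (θ f) m))) ⟩
    (pow f (suc k) ⊛ θ f) m +R fromℕ (suc k) * (pow f (suc k) ⊛ θ f) m
      ≈⟨ solve 2 (λ x n → x :+ n :* x := (con 1 :+ n) :* x) refl _ _ ⟩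
    fromℕ (suc (suc k)) * (pow f (suc k) ⊛ θ f) m ∎

  θ-t· : ∀ f → θ (t· f) ≋ t· (λ m → f m +R θ f m)
  θ-t· f zero = zeroˡ _
  θ-t· f (suc m) = trans (distribʳ _ _ _) (+-congʳ (*-identityˡ _))

  module WithInverses (inv : ℕ → Carrier) (inv-correct : ∀ m → fromℕ (suc m) * inv (suc m) ≈ 1#) where

    cancel-suc : ∀ n {x y} → fromℕ (suc n) * x ≈ fromℕ (suc n) * y → x ≈ y
    cancel-suc n {x} {y} eq = begin
      x                                    ≈⟨ *-identityˡ x ⟨
      1# * x                               ≈⟨ *-congʳ (inv-correct n) ⟨
      (fromℕ (suc n) * inv (suc n)) * x    ≈⟨ swap x ⟩
      inv (suc n) * (fromℕ (suc n) * x)    ≈⟨ *-congˡ eq ⟩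
      inv (suc n) * (fromℕ (suc n) * y)    ≈⟨ swap y ⟨
      (fromℕ (suc n) * inv (suc n)) * y    ≈⟨ *-congʳ (inv-correct n) ⟩
      1# * y                               ≈⟨ *-identityˡ y ⟩
      y                                    ∎
      where
      swap : ∀ z → (fromℕ (suc n) * inv (suc n)) * z ≈ inv (suc n) * (fromℕ (suc n) * z)
      swap z = solve 3 (λ f i x → (f :* i) :* x := i :* (f :* x)) refl _ _ z

    module Lagrange (a b : Series) (a0 : a 0 ≈ 1#) (ab : a ⊛ b ≋ δ) where

      b0 : b 0 ≈ 1#
      b0 = trans (sym (*-identityˡ (b 0))) (trans (*-congʳ (sym a0)) (ab 0))

      ba : b ⊛ a ≋ δ
      ba m = trans (⊛-comm b a m) (ab m)

      absorb : ∀ m → a ⊛ pow b (suc m) ≋ pow b m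
      absorb m r = trans (sym (⊛-assoc a b (pow b m) r)) (trans (⊛-congʳ (pow b m) ab r) (⊛-identityˡ (pow b m) r))

      pow-cancel : ∀ m k → pow a k ⊛ pow b (m + k) ≋ pow b m
      pow-cancel m k r = begin
        (pow a k ⊛ pow b (m + k)) r              ≈⟨ ⊛-congˡ (pow a k) (pow-+ b m k) r ⟩
        (pow a k ⊛ (pow b m ⊛ pow b k)) r        ≈⟨ ⊛-comm (pow a k) _ r ⟩
        ((pow b m ⊛ pow b k) ⊛ pow a k) r        ≈⟨ ⊛-assoc (pow b m) (pow b k) (pow a k) r ⟩
        (pow b m ⊛ (pow b k ⊛ pow a k)) r        ≈⟨ ⊛-congˡ (pow b m) (λ r → sym (pow-⊛ b a k r)) r ⟩
        (pow b m ⊛ pow (b ⊛ a) k) r              ≈⟨ ⊛-congˡ (pow b m) (λ r → trans (pow-cong ba k r) (pow-δ k r)) r ⟩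
        (pow b m ⊛ δ) r                          ≈⟨ ⊛-identityʳ _ r ⟩
        pow b m r                                ∎

      θ-reciprocal : θ b ≋ (λ m → - ((b ⊛ b) ⊛ θ a) m)
      θ-reciprocal m = +-inverseʳ-unique _ _ (begin
        ((b ⊛ b) ⊛ θ a) m +R θ b m
          ≈⟨ +-cong (trans (⊛-assoc b b (θ a) m) (⊛-congˡ b (⊛-comm b (θ a)) m))
                    (trans (sym (⊛-identityˡ (θ b) m)) (trans (⊛-congʳ (θ b) (λ r → sym (ba r)) m) (⊛-assoc b a (θ b) m))) ⟩
        (b ⊛ (θ a ⊛ b)) m +R (b ⊛ (a ⊛ θ b)) m   ≈⟨ ⊛-distribˡ b (θ a ⊛ b) (a ⊛ θ b) m ⟨
        (b ⊛ (λ r → (θ a ⊛ b) r +R (a ⊛ θ b) r)) m ≈⟨ ⊛-congˡ b (λ r → sym (θ-⊛ a b r)) m ⟩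
        (b ⊛ θ (a ⊛ b)) m                        ≈⟨ ⊛-congˡ b (λ r → trans (θ-cong ab r) (θ-δ r)) m ⟩
        (b ⊛ (λ _ → 0#)) m                       ≈⟨ ⊛-zeroʳ b m ⟩
        0# ∎)

      -- [t^j] b^j + [t^j] b^{j+1} θa = δ_j : the residue computation behind Lagrange inversion.
      residue : ∀ j → pow b j j +R (pow b (suc j) ⊛ θ a) j ≈ δ j
      residue zero = trans (+-congˡ (trans (*-congˡ (zeroˡ _)) (zeroʳ _))) (+-identityʳ _)
      residue (suc j) = trans (+-congʳ (cancel-suc j θ-power)) (-‿inverseˡ _)
        where
        w = (pow b (suc (suc j)) ⊛ θ a) (suc j)
        θ-power : fromℕ (suc j) * pow b (suc j) (suc j) ≈ fromℕ (suc j) * (- w)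
        θ-power = begin
          θ (pow b (suc j)) (suc j)
            ≈⟨ θ-pow b j (suc j) ⟩
          fromℕ (suc j) * (pow b j ⊛ θ b) (suc j)
            ≈⟨ *-congˡ (trans (⊛-congˡ (pow b j) θ-reciprocal (suc j)) (⊛-negʳ (pow b j) ((b ⊛ b) ⊛ θ a) (suc j))) ⟩
          fromℕ (suc j) * - (pow b j ⊛ ((b ⊛ b) ⊛ θ a)) (suc j)
            ≈⟨ *-congˡ (-‿cong (trans (sym (⊛-assoc (pow b j) (b ⊛ b) (θ a) (suc j)))
                                      (⊛-congʳ (θ a) (λ r → trans (⊛-comm (pow b j) (b ⊛ b) r) (⊛-assoc b b (pow b j) r)) (suc j)))) ⟩
          fromℕ (suc j) * (- w) ∎

      coeff-θ-power : ∀ n k → k ≤ n → (pow b (suc n) ⊛ θ (pow (t· a) (suc k))) (suc n) ≈ fromℕ (suc k) * δ (n ∸ k)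
      coeff-θ-power n k k≤n = begin
        (bⁿ ⊛ θ (pow (t· a) (suc k))) (suc n)
          ≈⟨ ⊛-congˡ bⁿ (θ-pow (t· a) k) (suc n) ⟩
        (bⁿ ⊛ (λ m → fromℕ (suc k) * (pow (t· a) k ⊛ θ (t· a)) m)) (suc n)
          ≈⟨ ⊛-scaleʳ (fromℕ (suc k)) bⁿ (pow (t· a) k ⊛ θ (t· a)) (suc n) ⟩
        fromℕ (suc k) * (bⁿ ⊛ (pow (t· a) k ⊛ θ (t· a))) (suc n)
          ≈⟨ *-congˡ inner ⟩
        fromℕ (suc k) * δ j ∎
        where
        bⁿ = pow b (suc n)
        j = n ∸ k
        suc-n≡ : suc n ≡ suc j + k
        suc-n≡ = ≡.cong suc (≡.sym (ℕP.m∸n+n≡m k≤n))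
        inner : (bⁿ ⊛ (pow (t· a) k ⊛ θ (t· a))) (suc n) ≈ δ j
        inner = begin
          (bⁿ ⊛ (pow (t· a) k ⊛ θ (t· a))) (suc n)
            ≈⟨ ⊛-assoc bⁿ (pow (t· a) k) (θ (t· a)) (suc n) ⟨
          ((bⁿ ⊛ pow (t· a) k) ⊛ θ (t· a)) (suc n)
            ≈⟨ ⊛-congʳ (θ (t· a)) (λ r → trans (⊛-comm bⁿ _ r) (⊛-congʳ bⁿ (pow-t· a k) r)) (suc n) ⟩
          ((t^ k · pow a k) ⊛ bⁿ ⊛ θ (t· a)) (suc n)
            ≈⟨ trans (⊛-congʳ (θ (t· a)) (⊛-t^·ˡ k (pow a k) bⁿ) (suc n)) (⊛-t^·ˡ k _ (θ (t· a)) (suc n)) ⟩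
          (t^ k · (pow a k ⊛ bⁿ ⊛ θ (t· a))) (suc n)
            ≈⟨ t^·-coeff k _ (ℕP.m≤n⇒m≤1+n k≤n) ⟩
          (pow a k ⊛ bⁿ ⊛ θ (t· a)) (suc n ∸ k)
            ≡⟨ ≡.cong (pow a k ⊛ bⁿ ⊛ θ (t· a)) (ℕP.+-∸-assoc 1 k≤n) ⟩
          (pow a k ⊛ bⁿ ⊛ θ (t· a)) (suc j)
            ≈⟨ ⊛-cong (λ r → trans (⊛-congˡ (pow a k) (λ r′ → reflexive (≡.cong (λ z → pow b z r′) suc-n≡)) r) (pow-cancel (suc j) k r)) (θ-t· a) (suc j) ⟩
          (pow b (suc j) ⊛ t· (λ m → a m +R θ a m)) (suc j)
            ≈⟨ trans (⊛-t·ʳ (pow b (suc j)) _ (suc j)) (⊛-distribˡ (pow b (suc j)) a (θ a) j) ⟩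
          (pow b (suc j) ⊛ a) j +R (pow b (suc j) ⊛ θ a) j
            ≈⟨ +-congʳ (trans (⊛-comm _ a j) (absorb j j)) ⟩
          pow b j j +R (pow b (suc j) ⊛ θ a) j
            ≈⟨ residue j ⟩
          δ j ∎

      coeff-θ-power-all : ∀ n i → i ≤ suc n → (pow b (suc n) ⊛ θ (pow (t· a) i)) (suc n) ≈ fromℕ i * δ (suc n ∸ i)
      coeff-θ-power-all n zero _ = trans (⊛-congˡ (pow b (suc n)) θ-δ (suc n)) (trans (⊛-zeroʳ _ (suc n)) (sym (zeroˡ _)))
      coeff-θ-power-all n (suc k) (s≤s k≤n) = coeff-θ-power n k k≤n

      coeff-θ-comp : ∀ κ n → (θ (comp κ a) ⊛ pow b (suc n)) (suc n) ≈ fromℕ (suc n) * κ (suc n)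
      coeff-θ-comp κ n = begin
        (θ (comp κ a) ⊛ bⁿ) (suc n)
          ≈⟨ trans (⊛-comm _ bⁿ (suc n)) (⊛-congˡ bⁿ (θ-lincomb κ (pow (t· a))) (suc n)) ⟩
        (bⁿ ⊛ lincomb κ (λ i → θ (pow (t· a) i))) (suc n)
          ≈⟨ ⊛-lincomb bⁿ κ (λ i → θ (pow (t· a) i)) (θ-orders (pow-t·-orders a)) (suc n) ⟩
        sumTo (suc n) (λ i → κ i * (bⁿ ⊛ θ (pow (t· a) i)) (suc n))
          ≈⟨ Σ-cong (suc n) (λ i i≤n → *-congˡ (coeff-θ-power-all n i i≤n)) ⟩
        sumTo (suc n) (λ i → κ i * (fromℕ i * δ (suc n ∸ i)))
          ≈⟨ Σ-last (suc n) _ (λ i i<n → trans (*-congˡ (trans (*-congˡ (off-diagonal i<n)) (zeroʳ _))) (zeroʳ _)) ⟩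
        κ (suc n) * (fromℕ (suc n) * δ (suc n ∸ suc n))
          ≡⟨ ≡.cong (λ d → κ (suc n) * (fromℕ (suc n) * δ d)) (ℕP.n∸n≡0 n) ⟩
        κ (suc n) * (fromℕ (suc n) * 1#)
          ≈⟨ solve 2 (λ x y → x :* (y :* con 1) := y :* x) refl _ _ ⟩
        fromℕ (suc n) * κ (suc n) ∎
        where
        bⁿ = pow b (suc n)
        off-diagonal : ∀ {i} → i < suc n → δ (suc n ∸ i) ≈ 0#
        off-diagonal {i} (s≤s i≤n) = reflexive (≡.cong δ (ℕP.+-∸-assoc 1 i≤n))

      lagrange : ∀ κ → κ 0 ≈ 1# → (∀ n → fromℕ (suc n) * κ (suc n) ≈ (θ a ⊛ pow b (suc n)) (suc n)) → comp κ a ≋ a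
      lagrange κ κ0 κ-coeff = <-rec (λ m → comp κ a m ≈ a m) step
        where
        step : ∀ n → (∀ {m} → m < n → comp κ a m ≈ a m) → comp κ a n ≈ a n
        step zero _ = trans (*-cong κ0 refl) (trans (*-identityˡ 1#) (sym a0))
        step (suc n) ih = cancel-suc n (begin
          fromℕ (suc n) * comp κ a (suc n)                 ≈⟨ *-identityʳ _ ⟨
          θ (comp κ a) (suc n) * 1#                        ≈⟨ *-congˡ leading ⟨
          θ (comp κ a) (suc n) * pow b (suc n) (n ∸ n)     ≈⟨ +-cancelˡ lower _ _ same-coeff ⟩
          θ a (suc n) * pow b (suc n) (n ∸ n)              ≈⟨ *-congˡ leading ⟩
          fromℕ (suc n) * a (suc n) * 1#                   ≈⟨ *-identityʳ _ ⟩
          fromℕ (suc n) * a (suc n)                        ∎)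
          where
          leading : pow b (suc n) (n ∸ n) ≈ 1#
          leading = trans (reflexive (≡.cong (pow b (suc n)) (ℕP.n∸n≡0 n))) (pow-constant b b0 (suc n))
          lower = sumTo n (λ j → θ a j * pow b (suc n) (suc n ∸ j))
          -- the coefficients below n+1 agree by induction, and the full ones by hypothesis
          same-coeff : lower +R θ (comp κ a) (suc n) * pow b (suc n) (n ∸ n) ≈ lower +R θ a (suc n) * pow b (suc n) (n ∸ n)
          same-coeff = begin
            lower +R θ (comp κ a) (suc n) * pow b (suc n) (n ∸ n)
              ≈⟨ +-congʳ (Σ-cong n (λ j j≤n → *-congʳ (*-congˡ (ih (s≤s j≤n))))) ⟨
            (θ (comp κ a) ⊛ pow b (suc n)) (suc n)  ≈⟨ coeff-θ-comp κ n ⟩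
            fromℕ (suc n) * κ (suc n)               ≈⟨ κ-coeff n ⟩
            (θ a ⊛ pow b (suc n)) (suc n)           ∎

    fact : ℕ → Carrier
    fact n = fromℕ (n !)

    ifact : ℕ → Carrier
    ifact zero = 1#
    ifact (suc n) = inv (suc n) * ifact n

    fact-suc : ∀ n → fact (suc n) ≈ fromℕ (suc n) * fact n
    fact-suc n = fromℕ-* (suc n) (n !)

    fact-ifact : ∀ n → fact n * ifact n ≈ 1#
    fact-ifact zero = trans (*-identityʳ _) (+-identityʳ 1#)
    fact-ifact (suc n) = begin
      fact (suc n) * (inv (suc n) * ifact n)
        ≈⟨ *-congʳ (fact-suc n) ⟩
      (fromℕ (suc n) * fact n) * (inv (suc n) * ifact n)
        ≈⟨ solve 4 (λ a b c d → (a :* b) :* (c :* d) := (a :* c) :* (b :* d)) refl _ _ _ _ ⟩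
      (fromℕ (suc n) * inv (suc n)) * (fact n * ifact n)
        ≈⟨ *-cong (inv-correct n) (fact-ifact n) ⟩
      1# * 1#
        ≈⟨ *-identityˡ 1# ⟩
      1# ∎

    cancel-pair : ∀ F {x y} Z → x * y ≈ 1# → F * ((x * y) * Z) ≈ F * Z
    cancel-pair F Z xy≈1 = *-congˡ (trans (*-congʳ xy≈1) (*-identityˡ Z))

    bin≈ : ∀ {n k} → k ≤ n → bin n k ≈ fact n * (ifact k * ifact (n ∸ k))
    bin≈ {n} {k} k≤n = begin
      bin n k
        ≈⟨ trans (*-congˡ (trans (*-cong (fact-ifact k) (fact-ifact (n ∸ k))) (*-identityˡ 1#))) (*-identityʳ _) ⟨
      bin n k * ((fact k * ifact k) * (fact (n ∸ k) * ifact (n ∸ k)))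
        ≈⟨ solve 5 (λ b x y z w → b :* ((x :* y) :* (z :* w)) := (b :* (x :* z)) :* (y :* w)) refl _ _ _ _ _ ⟩
      (bin n k * (fact k * fact (n ∸ k))) * (ifact k * ifact (n ∸ k))
        ≈⟨ *-congʳ (trans (*-congˡ (sym (fromℕ-* (k !) ((n ∸ k) !)))) (sym (fromℕ-* (n C k) _))) ⟩
      fromℕ ((n C k) ℕ.* (k ! ℕ.* (n ∸ k) !)) * (ifact k * ifact (n ∸ k))
        ≡⟨ ≡.cong (λ z → fromℕ z * (ifact k * ifact (n ∸ k))) (nCk*k!*[n∸k]!≡n! k≤n) ⟩
      fact n * (ifact k * ifact (n ∸ k)) ∎

    egf : Series → Series
    egf a n = a n * ifact n

    moment≈egf : ∀ a n → a n ≈ fact n * egf a n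
    moment≈egf a n = begin
      a n                         ≈⟨ *-identityˡ _ ⟨
      1# * a n                    ≈⟨ *-congʳ (fact-ifact n) ⟨
      (fact n * ifact n) * a n    ≈⟨ solve 3 (λ x y z → (x :* y) :* z := x :* (z :* y)) refl _ _ _ ⟩
      fact n * egf a n            ∎

    conv≈ : ∀ a b m → conv a b m ≈ fact m * (egf a ⊛ egf b) m
    conv≈ a b m = trans (Σ-cong m term) (sym (*-distrib-Σ m _ _))
      where
      term : ∀ j → j ≤ m → bin m j * (a j * b (m ∸ j)) ≈ fact m * (egf a j * egf b (m ∸ j))
      term j j≤m = trans (*-congʳ (bin≈ j≤m))
        (solve 5 (λ f x y u v → (f :* (x :* y)) :* (u :* v) := f :* ((u :* x) :* (v :* y))) refl _ _ _ _ _)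

    egf-conv : ∀ a b → egf (conv a b) ≋ egf a ⊛ egf b
    egf-conv a b m = begin
      conv a b m * ifact m                          ≈⟨ *-congʳ (conv≈ a b m) ⟩
      (fact m * (egf a ⊛ egf b) m) * ifact m        ≈⟨ solve 3 (λ x y z → (x :* y) :* z := (x :* z) :* y) refl _ _ _ ⟩
      (fact m * ifact m) * (egf a ⊛ egf b) m        ≈⟨ trans (*-congʳ (fact-ifact m)) (*-identityˡ _) ⟩
      (egf a ⊛ egf b) m                             ∎

    egf-δ : egf δ ≋ δ
    egf-δ zero = *-identityˡ _
    egf-δ (suc m) = zeroˡ _

    egf-natDot : ∀ a k → egf (natDot a k) ≋ pow (egf a) k
    egf-natDot a zero = egf-δ
    egf-natDot a (suc k) m = trans (egf-conv a (natDot a k) m) (⊛-congˡ (egf a) (egf-natDot a k) m)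

    natDot≈ : ∀ a k m → natDot a k m ≈ fact m * pow (egf a) k m
    natDot≈ a k m = trans (moment≈egf (natDot a k) m) (*-congˡ (egf-natDot a k m))

    invTab-stable : ∀ a {m N} → m ≤ N → invTab a N m ≡ invMom a m
    invTab-stable a {m} {N} m≤N = ≡.subst (λ N → invTab a N m ≡ invMom a m) (ℕP.m∸n+n≡m m≤N) (stable (N ∸ m))
      where
      stable : ∀ d → invTab a (d + m) m ≡ invMom a m
      stable zero = ≡.refl
      stable (suc d) with m ≡ᵇ suc (d + m) in eq
      ... | true = ⊥-elim (ℕP.1+n≰n (≡.subst (_≤ d + m) (ℕP.≡ᵇ⇒≡ m _ (≡.subst T (≡.sym eq) _)) (ℕP.m≤n+m m d)))
      ... | false = stable d

    invMom-suc : ∀ a n → invMom a (suc n) ≡ - sumTo n (λ j → bin (suc n) (suc j) * (a (suc j) * invTab a n (n ∸ j)))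
    invMom-suc a n rewrite Equivalence.to T-≡ (ℕP.≡⇒≡ᵇ n n ≡.refl) = ≡.refl

    conv-invMom : ∀ a → a 0 ≈ 1# → conv a (invMom a) ≋ δ
    conv-invMom a a0 zero = trans (*-congʳ (+-identityʳ 1#)) (trans (*-identityˡ _) (trans (*-identityʳ _) a0))
    conv-invMom a a0 (suc n) = begin
      conv a (invMom a) (suc n)
        ≈⟨ Σ-peel n _ ⟩
      bin (suc n) 0 * (a 0 * invMom a (suc n)) +R Y′
        ≈⟨ +-congʳ (trans (*-congʳ (+-identityʳ 1#)) (trans (*-identityˡ _) (*-cong a0 (reflexive (invMom-suc a n))))) ⟩
      1# * - Y +R Y′
        ≈⟨ +-cong (*-identityˡ _) (Σ-cong n (λ j _ → *-congˡ (*-congˡ (reflexive (≡.sym (invTab-stable a (ℕP.m∸n≤m n j))))))) ⟩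
      - Y +R Y
        ≈⟨ -‿inverseˡ Y ⟩
      0# ∎
      where
      Y = sumTo n (λ j → bin (suc n) (suc j) * (a (suc j) * invTab a n (n ∸ j)))
      Y′ = sumTo n (λ j → bin (suc n) (suc j) * (a (suc j) * invMom a (n ∸ j)))

    egf-invMom : ∀ a → a 0 ≈ 1# → egf a ⊛ egf (invMom a) ≋ δ
    egf-invMom a a0 m = trans (sym (egf-conv a (invMom a) m)) (trans (*-congʳ (conv-invMom a a0 m)) (egf-δ m))

    module Riordan (γ α : Series) (α0 : α 0 ≈ 1#) where
      g a b κ : Series
      g = egf γ
      a = egf α
      b = egf (invMom α)
      κ = egf (K α)

      G : ℕ → Series
      G k = g ⊛ pow a k

      riordan-unfold : ∀ {n k} → k ≤ n → riordan γ α n k ≡ bin n k * conv γ (natDot α k) (n ∸ k)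
      riordan-unfold k≤n rewrite Equivalence.to T-≡ (ℕP.≤⇒≤ᵇ k≤n) = ≡.refl

      riordan≈ : ∀ {n k} → k ≤ n → riordan γ α n k ≈ fact n * (ifact k * G k (n ∸ k))
      riordan≈ {n} {k} k≤n = begin
        riordan γ α n k
          ≡⟨ riordan-unfold k≤n ⟩
        bin n k * conv γ (natDot α k) (n ∸ k)
          ≈⟨ *-cong (bin≈ k≤n) (trans (conv≈ γ (natDot α k) (n ∸ k)) (*-congˡ (⊛-congˡ g (egf-natDot α k) (n ∸ k)))) ⟩
        (fact n * (ifact k * ifact (n ∸ k))) * (fact (n ∸ k) * G k (n ∸ k))
          ≈⟨ solve 5 (λ f x y u w → (f :* (x :* y)) :* (u :* w) := f :* ((u :* y) :* (x :* w))) refl _ _ _ _ _ ⟩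
        fact n * ((fact (n ∸ k) * ifact (n ∸ k)) * (ifact k * G k (n ∸ k)))
          ≈⟨ cancel-pair (fact n) _ (fact-ifact (n ∸ k)) ⟩
        fact n * (ifact k * G k (n ∸ k)) ∎

      K≈ : ∀ n → K α (suc n) ≈ fact n * (θ a ⊛ pow b (suc n)) (suc n)
      K≈ n = begin
        K α (suc n)                                          ≈⟨ Σ-cong n term ⟩
        sumTo n (λ j → fact n * (θ a (suc j) * bⁿ (n ∸ j)))  ≈⟨ *-distrib-Σ n (fact n) _ ⟨
        fact n * sumTo n (λ j → θ a (suc j) * bⁿ (n ∸ j))    ≈⟨ *-congˡ (sym (trans (⊛-peel (θ a) bⁿ n) constant-term-vanishes)) ⟩
        fact n * (θ a ⊛ bⁿ) (suc n)                          ∎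
        where
        bⁿ = pow b (suc n)
        constant-term-vanishes : θ a 0 * bⁿ (suc n) +R (drop₁ (θ a) ⊛ bⁿ) n ≈ (drop₁ (θ a) ⊛ bⁿ) n
        constant-term-vanishes = trans (+-congʳ (trans (*-congʳ (zeroˡ _)) (zeroˡ _))) (+-identityˡ _)
        term : ∀ j → j ≤ n → bin n j * (α (suc j) * natDot (invMom α) (suc n) (n ∸ j)) ≈ fact n * (θ a (suc j) * bⁿ (n ∸ j))
        term j j≤n = begin
          bin n j * (α (suc j) * natDot (invMom α) (suc n) (n ∸ j))
            ≈⟨ *-cong (bin≈ j≤n) (*-cong (trans (moment≈egf α (suc j)) (*-congʳ (fact-suc j))) (natDot≈ (invMom α) (suc n) (n ∸ j))) ⟩
          (fact n * (ifact j * ifact (n ∸ j))) * (((fromℕ (suc j) * fact j) * a (suc j)) * (fact (n ∸ j) * bⁿ (n ∸ j)))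
            ≈⟨ solve 8 (λ f x y s z u v p → (f :* (x :* y)) :* (((s :* z) :* u) :* (v :* p)) := f :* ((z :* x) :* ((v :* y) :* ((s :* u) :* p)))) refl _ _ _ _ _ _ _ _ ⟩
          fact n * ((fact j * ifact j) * ((fact (n ∸ j) * ifact (n ∸ j)) * (θ a (suc j) * bⁿ (n ∸ j))))
            ≈⟨ trans (cancel-pair (fact n) _ (fact-ifact j)) (cancel-pair (fact n) _ (fact-ifact (n ∸ j))) ⟩
          fact n * (θ a (suc j) * bⁿ (n ∸ j)) ∎

      K-coeff : ∀ n → fromℕ (suc n) * κ (suc n) ≈ (θ a ⊛ pow b (suc n)) (suc n)
      K-coeff n = begin
        fromℕ (suc n) * (K α (suc n) * (inv (suc n) * ifact n))
          ≈⟨ *-congˡ (*-congʳ (K≈ n)) ⟩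
        fromℕ (suc n) * ((fact n * M) * (inv (suc n) * ifact n))
          ≈⟨ solve 5 (λ s f m i j → s :* ((f :* m) :* (i :* j)) := (s :* i) :* ((f :* j) :* m)) refl _ _ _ _ _ ⟩
        (fromℕ (suc n) * inv (suc n)) * ((fact n * ifact n) * M)
          ≈⟨ *-cong (inv-correct n) (*-congʳ (fact-ifact n)) ⟩
        1# * (1# * M)
          ≈⟨ trans (*-identityˡ _) (*-identityˡ _) ⟩
        M ∎
        where M = (θ a ⊛ pow b (suc n)) (suc n)

      K-inverts : comp κ a ≋ a
      K-inverts = lagrange κ (*-identityˡ 1#) K-coeff
        where open Lagrange a b (trans (*-identityʳ _) α0) (egf-invMom α α0)

      step-down : ∀ n k X → fact (suc n) * (ifact (suc k) * X) ≈ (fromℕ (suc n) * inv (suc k)) * (fact n * (ifact k * X))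
      step-down n k X = trans (*-congʳ (fact-suc n))
        (solve 5 (λ s f i j x → (s :* f) :* ((i :* j) :* x) := (s :* i) :* (f :* (j :* x))) refl _ _ _ _ _)

      factor-out : ∀ m x y f → x * (y * sumTo m f) ≈ sumTo m (λ i → x * (y * f i))
      factor-out m x y f = trans (*-congˡ (*-distrib-Σ m y f)) (*-distrib-Σ m x _)

      -- First identity:  G (k+1) = a · G k.
      first-identity : ∀ n k → k ≤ n → riordan γ α (suc n) (suc k) ≈
        (fromℕ (suc n) * inv (suc k)) * sumTo (n ∸ k) (λ i → bin n i * (α i * riordan γ α (n ∸ i) k))
      first-identity n k k≤n = begin
        riordan γ α (suc n) (suc k)
          ≈⟨ trans (riordan≈ (s≤s k≤n)) (step-down n k _) ⟩
        c′ * (fact n * (ifact k * G (suc k) m))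
          ≈⟨ *-congˡ (*-congˡ (*-congˡ G-succ)) ⟩
        c′ * (fact n * (ifact k * (a ⊛ G k) m))
          ≈⟨ *-congˡ (factor-out m _ _ _) ⟩
        c′ * sumTo m (λ i → fact n * (ifact k * (a i * G k (m ∸ i))))
          ≈⟨ *-congˡ (Σ-cong m term) ⟨
        c′ * sumTo m (λ i → bin n i * (α i * riordan γ α (n ∸ i) k)) ∎
        where
        m = n ∸ k
        c′ = fromℕ (suc n) * inv (suc k)
        G-succ : G (suc k) m ≈ (a ⊛ G k) m
        G-succ = begin
          (g ⊛ (a ⊛ pow a k)) m    ≈⟨ ⊛-assoc g a (pow a k) m ⟨
          ((g ⊛ a) ⊛ pow a k) m    ≈⟨ ⊛-congʳ (pow a k) (⊛-comm g a) m ⟩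
          ((a ⊛ g) ⊛ pow a k) m    ≈⟨ ⊛-assoc a g (pow a k) m ⟩
          (a ⊛ G k) m              ∎
        term : ∀ i → i ≤ m → bin n i * (α i * riordan γ α (n ∸ i) k) ≈ fact n * (ifact k * (a i * G k (m ∸ i)))
        term i i≤m = begin
          bin n i * (α i * riordan γ α (n ∸ i) k)
            ≈⟨ *-cong (bin≈ (ℕP.≤-trans i≤m (ℕP.m∸n≤m n k))) (*-cong (moment≈egf α i) (riordan≈ k≤n∸i)) ⟩
          (fact n * (ifact i * ifact (n ∸ i))) * ((fact i * a i) * (fact (n ∸ i) * (ifact k * G k (n ∸ i ∸ k))))
            ≡⟨ ≡.cong (λ r → (fact n * (ifact i * ifact (n ∸ i))) * ((fact i * a i) * (fact (n ∸ i) * (ifact k * G k r))))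
                     reindex ⟩
          (fact n * (ifact i * ifact (n ∸ i))) * ((fact i * a i) * (fact (n ∸ i) * (ifact k * G k (m ∸ i))))
            ≈⟨ solve 8 (λ f x y z u v w h → (f :* (x :* y)) :* ((z :* u) :* (v :* (w :* h))) := f :* ((z :* x) :* ((v :* y) :* (w :* (u :* h))))) refl _ _ _ _ _ _ _ _ ⟩
          fact n * ((fact i * ifact i) * ((fact (n ∸ i) * ifact (n ∸ i)) * (ifact k * (a i * G k (m ∸ i)))))
            ≈⟨ trans (cancel-pair (fact n) _ (fact-ifact i)) (cancel-pair (fact n) _ (fact-ifact (n ∸ i))) ⟩
          fact n * (ifact k * (a i * G k (m ∸ i))) ∎
          where
          k≤n∸i : k ≤ n ∸ i
          k≤n∸i = ℕP.m+n≤o⇒m≤o∸n k (≡.subst (_≤ n) (ℕP.+-comm i k) (ℕP.m≤o∸n⇒m+n≤o i k≤n i≤m))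
          reindex : n ∸ i ∸ k ≡ m ∸ i
          reindex = ≡.trans (ℕP.∸-+-assoc n i k) (≡.trans (≡.cong (n ∸_) (ℕP.+-comm i k)) (≡.sym (ℕP.∸-+-assoc n k i)))

      G-+ : ∀ k i → G (k + i) ≋ G k ⊛ pow a i
      G-+ k i r = trans (⊛-congˡ g (pow-+ a k i) r) (sym (⊛-assoc g (pow a k) (pow a i) r))

      -- Second identity:  G (k+1) = G k · a = G k · κ(t a) = Σ_i κ_i t^i G (k+i).
      second-identity : ∀ n k → k ≤ n → riordan γ α (suc n) (suc k) ≈
        (fromℕ (suc n) * inv (suc k)) * sumTo (n ∸ k) (λ i → bin (k + i) i * (K α i * riordan γ α n (k + i)))
      second-identity n k k≤n = begin
        riordan γ α (suc n) (suc k)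
          ≈⟨ trans (riordan≈ (s≤s k≤n)) (step-down n k _) ⟩
        c′ * (fact n * (ifact k * G (suc k) m))
          ≈⟨ *-congˡ (*-congˡ (*-congˡ G-succ)) ⟩
        c′ * (fact n * (ifact k * (G k ⊛ comp κ a) m))
          ≈⟨ *-congˡ (*-congˡ (*-congˡ (comp-coeff (G k) κ a m))) ⟩
        c′ * (fact n * (ifact k * sumTo m (λ i → κ i * (G k ⊛ pow a i) (m ∸ i))))
          ≈⟨ *-congˡ (factor-out m _ _ _) ⟩
        c′ * sumTo m (λ i → fact n * (ifact k * (κ i * (G k ⊛ pow a i) (m ∸ i))))
          ≈⟨ *-congˡ (Σ-cong m term) ⟨
        c′ * sumTo m (λ i → bin (k + i) i * (K α i * riordan γ α n (k + i))) ∎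
        where
        m = n ∸ k
        c′ = fromℕ (suc n) * inv (suc k)
        G-succ : G (suc k) m ≈ (G k ⊛ comp κ a) m
        G-succ = begin
          (g ⊛ (a ⊛ pow a k)) m    ≈⟨ ⊛-congˡ g (⊛-comm a (pow a k)) m ⟩
          (g ⊛ (pow a k ⊛ a)) m    ≈⟨ ⊛-assoc g (pow a k) a m ⟨
          (G k ⊛ a) m              ≈⟨ ⊛-congˡ (G k) K-inverts m ⟨
          (G k ⊛ comp κ a) m       ∎
        term : ∀ i → i ≤ m → bin (k + i) i * (K α i * riordan γ α n (k + i)) ≈ fact n * (ifact k * (κ i * (G k ⊛ pow a i) (m ∸ i)))
        term i i≤m = begin
          bin (k + i) i * (K α i * riordan γ α n (k + i))
            ≈⟨ *-cong (bin≈ (ℕP.m≤n+m i k)) (*-cong (moment≈egf (K α) i) (riordan≈ k+i≤n)) ⟩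
          (fact (k + i) * (ifact i * ifact (k + i ∸ i))) * ((fact i * κ i) * (fact n * (ifact (k + i) * G (k + i) (n ∸ (k + i)))))
            ≡⟨ ≡.cong₂ (λ u r → (fact (k + i) * (ifact i * ifact u)) * ((fact i * κ i) * (fact n * (ifact (k + i) * G (k + i) r))))
                       (ℕP.m+n∸n≡m k i) (≡.sym (ℕP.∸-+-assoc n k i)) ⟩
          (fact (k + i) * (ifact i * ifact k)) * ((fact i * κ i) * (fact n * (ifact (k + i) * G (k + i) (m ∸ i))))
            ≈⟨ *-congˡ (*-congˡ (*-congˡ (*-congˡ (G-+ k i (m ∸ i))))) ⟩
          (fact (k + i) * (ifact i * ifact k)) * ((fact i * κ i) * (fact n * (ifact (k + i) * (G k ⊛ pow a i) (m ∸ i))))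
            ≈⟨ solve 8 (λ f x y z u v w h → (f :* (x :* y)) :* ((z :* u) :* (v :* (w :* h))) := v :* ((f :* w) :* ((z :* x) :* (y :* (u :* h))))) refl _ _ _ _ _ _ _ _ ⟩
          fact n * ((fact (k + i) * ifact (k + i)) * ((fact i * ifact i) * (ifact k * (κ i * (G k ⊛ pow a i) (m ∸ i)))))
            ≈⟨ trans (cancel-pair (fact n) _ (fact-ifact (k + i))) (cancel-pair (fact n) _ (fact-ifact i)) ⟩
          fact n * (ifact k * (κ i * (G k ⊛ pow a i) (m ∸ i))) ∎
          where
          k+i≤n : k + i ≤ n
          k+i≤n = ≡.subst (_≤ n) (ℕP.+-comm i k) (ℕP.m≤o∸n⇒m+n≤o i k≤n i≤m)

      -- Third identity:  G k = g · κ(t a)^k = g · (κ^k)(t a) = Σ_i [t^i]κ^k t^i G i.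
      third-identity : ∀ n k → k ≤ n → riordan γ α n k ≈
        bin n k * sumTo (n ∸ k) (λ i → natDot (K α) k i * riordan γ α (n ∸ k) i)
      third-identity n k k≤n = begin
        riordan γ α n k
          ≈⟨ riordan≈ k≤n ⟩
        fact n * (ifact k * G k m)
          ≈⟨ cancel-pair (fact n) _ (fact-ifact m) ⟨
        fact n * ((fact m * ifact m) * (ifact k * G k m))
          ≈⟨ solve 5 (λ f x y z h → f :* ((x :* y) :* (z :* h)) := (f :* (z :* y)) :* (x :* h)) refl _ _ _ _ _ ⟩
        (fact n * (ifact k * ifact m)) * (fact m * G k m)
          ≈⟨ *-cong (sym (bin≈ k≤n)) (*-congˡ G-expand) ⟩
        bin n k * (fact m * sumTo m (λ i → pow κ k i * G i (m ∸ i)))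
          ≈⟨ *-congˡ (*-distrib-Σ m _ _) ⟩
        bin n k * sumTo m (λ i → fact m * (pow κ k i * G i (m ∸ i)))
          ≈⟨ *-congˡ (Σ-cong m term) ⟨
        bin n k * sumTo m (λ i → natDot (K α) k i * riordan γ α m i) ∎
        where
        m = n ∸ k
        G-expand : G k m ≈ sumTo m (λ i → pow κ k i * G i (m ∸ i))
        G-expand = begin
          (g ⊛ pow a k) m               ≈⟨ ⊛-congˡ g (pow-cong K-inverts k) m ⟨
          (g ⊛ pow (comp κ a) k) m      ≈⟨ ⊛-congˡ g (comp-pow κ a k) m ⟨
          (g ⊛ comp (pow κ k) a) m      ≈⟨ comp-coeff g (pow κ k) a m ⟩
          sumTo m (λ i → pow κ k i * G i (m ∸ i)) ∎
        term : ∀ i → i ≤ m → natDot (K α) k i * riordan γ α m i ≈ fact m * (pow κ k i * G i (m ∸ i))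
        term i i≤m = begin
          natDot (K α) k i * riordan γ α m i
            ≈⟨ *-cong (trans (moment≈egf (natDot (K α) k) i) (*-congˡ (egf-natDot (K α) k i))) (riordan≈ i≤m) ⟩
          (fact i * pow κ k i) * (fact m * (ifact i * G i (m ∸ i)))
            ≈⟨ solve 5 (λ x p f y h → (x :* p) :* (f :* (y :* h)) := f :* ((x :* y) :* (p :* h))) refl _ _ _ _ _ ⟩
          fact m * ((fact i * ifact i) * (pow κ k i * G i (m ∸ i)))
            ≈⟨ cancel-pair (fact m) _ (fact-ifact i) ⟩
          fact m * (pow κ k i * G i (m ∸ i)) ∎

theorem2p6 : ∀ {c ℓ : Level} (R : CommutativeRing c ℓ) →
    let open CommutativeRing R renaming (_+_ to _+R_)
        open Umbral R
    in (inv : ℕ → Carrier) →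
       (∀ m → fromℕ (suc m) * inv (suc m) ≈ 1#) →
       (γ α : ℕ → Carrier) → γ 0 ≈ 1# → α 0 ≈ 1# →
       ∀ n k → 1 ≤ k → k ≤ n →
         (riordan γ α n k ≈ (fromℕ n * inv k) *
            sumTo (n ∸ k) (λ i → bin (n ∸ 1) i * (α i * riordan γ α (n ∸ 1 ∸ i) (k ∸ 1))))
       × (riordan γ α n k ≈ (fromℕ n * inv k) *
            sumTo (n ∸ k) (λ i → bin (k ∸ 1 + i) i * (K α i * riordan γ α (n ∸ 1) (k ∸ 1 + i))))
       × (riordan γ α n k ≈ bin n k *
            sumTo (n ∸ k) (λ i → natDot (K α) k i * riordan γ α (n ∸ k) i))
theorem2p6 R inv inv-correct γ α _ α0 (suc n) (suc k) (s≤s z≤n) (s≤s k≤n) =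
  first-identity n k k≤n , second-identity n k k≤n , third-identity (suc n) (suc k) (s≤s k≤n)
  where open WithInverses R inv inv-correct
        open Riordan γ α α0
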